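{- Let $K$ be a Kripke structure and let $\varphi$ be a $\mathrm{CTL}^*$ formula that is monotone in a subformula $\psi$. Then the following are equivalent: (i) $\varphi$ is syntactically vacuous in $\psi$ in $K$; (ii) $\varphi$ is structure vacuous in $\psi$ in $K$; (iii) $\varphi$ is bisimulation vacuous in $\psi$ in $K$.
   Context: A Kripke structure $K=(AP,S,R,s_0,I)$ consists of a set $AP$ of atomic propositions, a finite set $S$ of states, a total transition relation $R\subseteq S\times S$, an initial state $s_0$, and a labeling $I:S\to 2^{AP}$. $\mathrm{CTL}^*$ has the standard syntax and semantics; $K\models\varphi$ means $K,s_0\models\varphi$. A set of states $Y\subseteq S$ may be used as an atomic proposition, with $K,s\models Y$ iff $s\in Y$. $\varphi[\psi\leftarrow y]$ denotes replacing every occurrence of $\psi$ in $\varphi$ by $y$. $\varphi$ is monotone in $\psi$ if either whenever $x\Rightarrow y$ is valid so is $\varphi[\psi\leftarrow x]\Rightarrow\varphi[\psi\leftarrow y]$, or whenever $x\Rightarrow y$ is valid so is $\varphi[\psi\leftarrow y]\Rightarrow\varphi[\psi\leftarrow x]$. Syntactic vacuity: for every $\mathrm{CTL}^*$ state formula $\psi'$, $K\models\varphi\Leftrightarrow K\models\varphi[\psi\leftarrow\psi']$. Structure vacuity: either $K\models\varphi[\psi\leftarrow Y]$ for all $Y\subseteq S$, or $K\models\neg\varphi[\psi\leftarrow Y]$ for all $Y\subseteq S$. Bisimulation vacuity: a bisimulation w.r.t. a set $X$ of common atomic propositions between two structures is a relation between states such that related states have the same labels on $X$ and each transition from one of two related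 states is matched by a transition of the other to a related state (in both directions); $\mathcal{B}(K)$ is the set of structures bisimilar to $K$ w.r.t. $AP$ with initial states related; $\varphi$ is bisimulation $\psi$-vacuous in $K$ iff either for all $K'\in\mathcal{B}(K)$ and all $Y\subseteq S'$, $K'\models\varphi[\psi\leftarrow Y]$, or for all $K'\in\mathcal{B}(K)$ and all $Y\subseteq S'$, $K'\models\neg\varphi[\psi\leftarrow Y]$. -}

module Defs where

open import Data.Nat using (ℕ; zero; suc; _+_; _<_)
open import Data.Fin using (Fin)
open import Data.Fin.Subset using (Subset)
open import Data.Vec using (lookup)
open import Data.Bool using (Bool; true; false)
open import Data.Product using (Σ; _×_; _,_; proj₁)
open import Data.Sum using (_⊎_; inj₁; inj₂)
open import Data.Unit using (⊤)
open import Function using (id)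
open import Relation.Nullary using (¬_; Dec; yes; no)
open import Relation.Binary.PropositionalEquality using (_≡_; refl)
open import Relation.Binary.Definitions using (DecidableEquality)

record Kripke (AP : Set) : Set where
  field
    n     : ℕ
    R     : Fin n → Fin n → Bool
    total : ∀ s → Σ (Fin n) λ t → R s t ≡ true
    s₀    : Fin n
    I     : Fin n → AP → Bool

infixr 6 _∧ₛ_ _∧ₚ_
infixr 7 _𝐔_

mutual
  data SF (A : Set) : Set where
    tt    : SF A
    atom  : A → SF A
    ¬ₛ    : SF A → SF A
    _∧ₛ_  : SF A → SF A → SF A
    𝐄     : PF A → SF A

  data PF (A : Set) : Set where
    st    : SF A → PF A
    ¬ₚ    : PF A → PF A
    _∧ₚ_  : PF A → PF A → PF A
    𝐗     : PF A → PF A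
    _𝐔_   : PF A → PF A → PF A

mutual
  data _⊑ₛ_ {A : Set} (ψ : SF A) : SF A → Set where
    here : ψ ⊑ₛ ψ
    ¬ₛ   : ∀ {f} → ψ ⊑ₛ f → ψ ⊑ₛ ¬ₛ f
    ∧ˡ   : ∀ {f g} → ψ ⊑ₛ f → ψ ⊑ₛ (f ∧ₛ g)
    ∧ʳ   : ∀ {f g} → ψ ⊑ₛ g → ψ ⊑ₛ (f ∧ₛ g)
    𝐄    : ∀ {f} → ψ ⊑ₚ f → ψ ⊑ₛ 𝐄 f

  data _⊑ₚ_ {A : Set} (ψ : SF A) : PF A → Set where
    st   : ∀ {f} → ψ ⊑ₛ f → ψ ⊑ₚ st f
    ¬ₚ   : ∀ {f} → ψ ⊑ₚ f → ψ ⊑ₚ ¬ₚ f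
    ∧ˡ   : ∀ {f g} → ψ ⊑ₚ f → ψ ⊑ₚ (f ∧ₚ g)
    ∧ʳ   : ∀ {f g} → ψ ⊑ₚ g → ψ ⊑ₚ (f ∧ₚ g)
    𝐗    : ∀ {f} → ψ ⊑ₚ f → ψ ⊑ₚ 𝐗 f
    𝐔ˡ   : ∀ {f g} → ψ ⊑ₚ f → ψ ⊑ₚ (f 𝐔 g)
    𝐔ʳ   : ∀ {f g} → ψ ⊑ₚ g → ψ ⊑ₚ (f 𝐔 g)

module FormulaEq {A : Set} (_≟_ : DecidableEquality A) where
 mutual
  decS : DecidableEquality (SF A)
  decS tt tt = yes refl
  decS tt (atom y0) = no λ ()
  decS tt (¬ₛ y0) = no λ ()
  decS tt (y0 ∧ₛ y1) = no λ ()
  decS tt (𝐄 y0) = no λ ()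
  decS (atom x0) tt = no λ ()
  decS (atom x0) (atom y0) with _≟_ x0 y0
  ... | yes refl = yes refl
  ... | no ne = no λ { refl → ne refl }
  decS (atom x0) (¬ₛ y0) = no λ ()
  decS (atom x0) (y0 ∧ₛ y1) = no λ ()
  decS (atom x0) (𝐄 y0) = no λ ()
  decS (¬ₛ x0) tt = no λ ()
  decS (¬ₛ x0) (atom y0) = no λ ()
  decS (¬ₛ x0) (¬ₛ y0) with decS x0 y0
  ... | yes refl = yes refl
  ... | no ne = no λ { refl → ne refl }
  decS (¬ₛ x0) (y0 ∧ₛ y1) = no λ ()
  decS (¬ₛ x0) (𝐄 y0) = no λ ()
  decS (x0 ∧ₛ x1) tt = no λ ()
  decS (x0 ∧ₛ x1) (atom y0) = no λ ()
  decS (x0 ∧ₛ x1) (¬ₛ y0) = no λ ()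
  decS (x0 ∧ₛ x1) (y0 ∧ₛ y1) with decS x0 y0 | decS x1 y1
  ... | yes refl | yes refl = yes refl
  ... | no ne | _ = no λ { refl → ne refl }
  ... | yes _ | no ne = no λ { refl → ne refl }
  decS (x0 ∧ₛ x1) (𝐄 y0) = no λ ()
  decS (𝐄 x0) tt = no λ ()
  decS (𝐄 x0) (atom y0) = no λ ()
  decS (𝐄 x0) (¬ₛ y0) = no λ ()
  decS (𝐄 x0) (y0 ∧ₛ y1) = no λ ()
  decS (𝐄 x0) (𝐄 y0) with decP x0 y0
  ... | yes refl = yes refl
  ... | no ne = no λ { refl → ne refl }
  decP : DecidableEquality (PF A)
  decP (st x0) (st y0) with decS x0 y0
  ... | yes refl = yes refl
  ... | no ne = no λ { refl → ne refl }
  decP (st x0) (¬ₚ y0) = no λ ()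
  decP (st x0) (y0 ∧ₚ y1) = no λ ()
  decP (st x0) (𝐗 y0) = no λ ()
  decP (st x0) (y0 𝐔 y1) = no λ ()
  decP (¬ₚ x0) (st y0) = no λ ()
  decP (¬ₚ x0) (¬ₚ y0) with decP x0 y0
  ... | yes refl = yes refl
  ... | no ne = no λ { refl → ne refl }
  decP (¬ₚ x0) (y0 ∧ₚ y1) = no λ ()
  decP (¬ₚ x0) (𝐗 y0) = no λ ()
  decP (¬ₚ x0) (y0 𝐔 y1) = no λ ()
  decP (x0 ∧ₚ x1) (st y0) = no λ ()
  decP (x0 ∧ₚ x1) (¬ₚ y0) = no λ ()
  decP (x0 ∧ₚ x1) (y0 ∧ₚ y1) with decP x0 y0 | decP x1 y1
  ... | yes refl | yes refl = yes refl
  ... | no ne | _ = no λ { refl → ne refl }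
  ... | yes _ | no ne = no λ { refl → ne refl }
  decP (x0 ∧ₚ x1) (𝐗 y0) = no λ ()
  decP (x0 ∧ₚ x1) (y0 𝐔 y1) = no λ ()
  decP (𝐗 x0) (st y0) = no λ ()
  decP (𝐗 x0) (¬ₚ y0) = no λ ()
  decP (𝐗 x0) (y0 ∧ₚ y1) = no λ ()
  decP (𝐗 x0) (𝐗 y0) with decP x0 y0
  ... | yes refl = yes refl
  ... | no ne = no λ { refl → ne refl }
  decP (𝐗 x0) (y0 𝐔 y1) = no λ ()
  decP (x0 𝐔 x1) (st y0) = no λ ()
  decP (x0 𝐔 x1) (¬ₚ y0) = no λ ()
  decP (x0 𝐔 x1) (y0 ∧ₚ y1) = no λ ()
  decP (x0 𝐔 x1) (𝐗 y0) = no λ ()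
  decP (x0 𝐔 x1) (y0 𝐔 y1) with decP x0 y0 | decP x1 y1
  ... | yes refl | yes refl = yes refl
  ... | no ne | _ = no λ { refl → ne refl }
  ... | yes _ | no ne = no λ { refl → ne refl }

module Sem {A : Set} (K : Kripke A) where
  open Kripke K

  Path : Set
  Path = Σ (ℕ → Fin n) λ π → ∀ i → R (π i) (π (suc i)) ≡ true

  suffix : Path → ℕ → Path
  suffix (π , p) k = (λ i → π (i + k)) , (λ i → p (i + k))

  first : Path → Fin n
  first π = proj₁ π 0

  mutual
    _⊨ₛ_ : Fin n → SF A → Set
    s ⊨ₛ tt       = ⊤
    s ⊨ₛ atom p   = I s p ≡ true
    s ⊨ₛ ¬ₛ f     = ¬ (s ⊨ₛ f)
    s ⊨ₛ (f ∧ₛ g) = (s ⊨ₛ f) × (s ⊨ₛ g)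
    s ⊨ₛ 𝐄 f      = Σ Path λ π → (first π ≡ s) × (π ⊨ₚ f)

    _⊨ₚ_ : Path → PF A → Set
    π ⊨ₚ st f     = first π ⊨ₛ f
    π ⊨ₚ ¬ₚ f     = ¬ (π ⊨ₚ f)
    π ⊨ₚ (f ∧ₚ g) = (π ⊨ₚ f) × (π ⊨ₚ g)
    π ⊨ₚ 𝐗 f      = suffix π 1 ⊨ₚ f
    π ⊨ₚ (f 𝐔 g)  = Σ ℕ λ k → (suffix π k ⊨ₚ g) × (∀ j → j < k → suffix π j ⊨ₚ f)

  ⊨_ : SF A → Set
  ⊨ φ = s₀ ⊨ₛ φ

open Kripke public

-- The structure K in which every set of states Y ⊆ S is additionally
-- an atomic proposition (K, s ⊨ Y iff s ∈ Y).

withSets : {AP : Set} (K : Kripke AP) → Kripke (AP ⊎ Subset (n K))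
withSets K = record
  { n = n K ; R = R K ; total = total K ; s₀ = s₀ K
  ; I = λ { s (inj₁ p) → I K s p ; s (inj₂ Y) → lookup Y s } }

Valid⇒ : {B : Set} → SF B → SF B → Set
Valid⇒ {B} x y = ∀ (M : Kripke B) (s : Fin (n M)) → Sem._⊨ₛ_ M s x → Sem._⊨ₛ_ M s y

record IsBisim {AP : Set} (K K' : Kripke AP) (ρ : Fin (n K) → Fin (n K') → Set) : Set where
  field
    labels : ∀ {s s'} → ρ s s' → ∀ p → I K s p ≡ I K' s' p
    forth  : ∀ {s s' t} → ρ s s' → R K s t ≡ true →
             Σ (Fin (n K')) λ t' → (R K' s' t' ≡ true) × ρ t t'
    back   : ∀ {s s' t'} → ρ s s' → R K' s' t' ≡ true →
             Σ (Fin (n K)) λ t → (R K s t ≡ true) × ρ t t'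

Bisimilar : {AP : Set} → Kripke AP → Kripke AP → Set₁
Bisimilar K K' = Σ (Fin (n K) → Fin (n K') → Set) λ ρ → IsBisim K K' ρ × ρ (s₀ K) (s₀ K')

module Vacuity {AP : Set} (_≟_ : DecidableEquality AP) where
  open FormulaEq _≟_

  private
    choose : {P : Set} {X : Set} → Dec P → X → X → X
    choose (yes _) x y = x
    choose (no _)  x y = y

  module _ {B : Set} (ι : AP → B) (ψ : SF AP) (y : SF B) where
    mutual
      replS : SF AP → SF B
      replS φ = choose (decS φ ψ) y (goS φ)

      goS : SF AP → SF B
      goS tt       = tt
      goS (atom p) = atom (ι p)
      goS (¬ₛ f)   = ¬ₛ (replS f)
      goS (f ∧ₛ g) = replS f ∧ₛ replS g
      goS (𝐄 f)    = 𝐄 (replP f)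

      replP : PF AP → PF B
      replP (st f)   = st (replS f)
      replP (¬ₚ f)   = ¬ₚ (replP f)
      replP (f ∧ₚ g) = replP f ∧ₚ replP g
      replP (𝐗 f)    = 𝐗 (replP f)
      replP (f 𝐔 g)  = replP f 𝐔 replP g

  _[_←_] : SF AP → SF AP → SF AP → SF AP
  φ [ ψ ← ψ' ] = replS id ψ ψ' φ

  _[_←⁺_] : {Z : Set} → SF AP → SF AP → SF (AP ⊎ Z) → SF (AP ⊎ Z)
  φ [ ψ ←⁺ x ] = replS inj₁ ψ x φ

  _[_←Y_] : {K : Kripke AP} → SF AP → SF AP → Subset (n K) → SF (AP ⊎ Subset (n K))
  φ [ ψ ←Y Y ] = replS inj₁ ψ (atom (inj₂ Y)) φ

  Monotone : SF AP → SF AP → Set₁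
  Monotone φ ψ =
      (∀ (Z : Set) (x y : SF (AP ⊎ Z)) → Valid⇒ x y → Valid⇒ (φ [ ψ ←⁺ x ]) (φ [ ψ ←⁺ y ]))
    ⊎ (∀ (Z : Set) (x y : SF (AP ⊎ Z)) → Valid⇒ x y → Valid⇒ (φ [ ψ ←⁺ y ]) (φ [ ψ ←⁺ x ]))

  SyntacticVacuous : Kripke AP → SF AP → SF AP → Set
  SyntacticVacuous K φ ψ =
    ∀ (ψ' : SF AP) → (Sem.⊨_ K φ → Sem.⊨_ K (φ [ ψ ← ψ' ])) × (Sem.⊨_ K (φ [ ψ ← ψ' ]) → Sem.⊨_ K φ)

  StructureVacuous : Kripke AP → SF AP → SF AP → Set
  StructureVacuous K φ ψ =
      (∀ (Y : Subset (n K)) → Sem.⊨_ (withSets K) (_[_←Y_] {K} φ ψ Y))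
    ⊎ (∀ (Y : Subset (n K)) → Sem.⊨_ (withSets K) (¬ₛ (_[_←Y_] {K} φ ψ Y)))

  BisimulationVacuous : Kripke AP → SF AP → SF AP → Set₁
  BisimulationVacuous K φ ψ =
      (∀ (K' : Kripke AP) → Bisimilar K K' → ∀ (Y : Subset (n K')) →
          Sem.⊨_ (withSets K') (_[_←Y_] {K'} φ ψ Y))
    ⊎ (∀ (K' : Kripke AP) → Bisimilar K K' → ∀ (Y : Subset (n K')) →
          Sem.⊨_ (withSets K') (¬ₛ (_[_←Y_] {K'} φ ψ Y)))

module Submission where

-- The whole argument rests on one invariance fact (transfer): if ρ is a
-- bisimulation between two structures and the formulas x, x' substituted
-- for ψ agree along ρ, then φ[ψ ← x] and φ[ψ ← x'] agree along ρ.  Three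
-- instances of it are used: K versus K extended by sets of states, a
-- structure versus itself, and a bisimulation K ~ K' lifted to the
-- extensions by sets.
--
-- Monotonicity squeezes every instance φ[ψ ← Y] between the instances at
-- the two constant sets (empty and full).  Hence all three vacuity
-- notions are equivalent to "extreme vacuity": φ holds at the lower
-- constant set or fails at the upper one.  Structure vacuity reduces to it
-- directly, it is invariant under bisimulation (constant sets agree along
-- any relation), and syntactic vacuity meets it through two translations:
-- constant formulas correspond to constant sets, and, classically, every
-- state formula ψ' corresponds to the set of states satisfying it.

open import Defs
open import Axiom.ExcludedMiddle using (ExcludedMiddle)
open import Level using (0ℓ)
open import Data.Nat using (ℕ; zero; suc; _+_)
open import Data.Fin using (Fin)
open import Data.Fin.Subset using (Subset)
open import Data.Vec using (lookup; replicate; tabulate)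
open import Data.Vec.Properties using (lookup-replicate; lookup∘tabulate)
open import Data.Bool using (Bool; true; false; not)
open import Data.Product using (Σ; _×_; _,_; proj₁; proj₂)
open import Data.Product.Function.NonDependent.Propositional using (_×-⇔_)
open import Data.Sum using (_⊎_; inj₁; inj₂)
open import Data.Unit using () renaming (tt to ⋆)
open import Data.Empty using (⊥-elim)
open import Function using (id; flip)
open import Function.Bundles using (_⇔_; mk⇔; Equivalence)
open import Function.Related.TypeIsomorphisms using (¬-cong-⇔)
open import Relation.Nullary using (¬_; Dec; yes; no; does)
open import Relation.Binary.Definitions using (DecidableEquality)
open import Relation.Binary.PropositionalEquality using (_≡_; refl; sym; trans; subst; cong; cong₂)

open Equivalence using (to; from)

Simulation : {B B' : Set} (M : Kripke B) (M' : Kripke B') →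
             (Fin (n M) → Fin (n M') → Set) → Set
Simulation M M' ρ = ∀ {s s' t} → ρ s s' → R M s t ≡ true →
                    Σ (Fin (n M')) λ t' → (R M' s' t' ≡ true) × ρ t t'

PathRel : {B B' : Set} (M : Kripke B) (M' : Kripke B') →
          (Fin (n M) → Fin (n M') → Set) → Sem.Path M → Sem.Path M' → Set
PathRel M M' ρ π π' = ∀ i → ρ (proj₁ π i) (proj₁ π' i)

liftPath : {B B' : Set} {M : Kripke B} {M' : Kripke B'}
           {ρ : Fin (n M) → Fin (n M') → Set} → Simulation M M' ρ →
           (π : Sem.Path M) → ∀ {s'} → ρ (Sem.first M π) s' →
           Σ (Sem.Path M') λ π' → (Sem.first M' π' ≡ s') × PathRel M M' ρ π π'
liftPath {M' = M'} {ρ = ρ} sim (π , edge) {s'} r =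
  ((λ i → proj₁ (follow i)) , nextEdge) , refl , (λ i → proj₂ (follow i))
  where
  follow : (i : ℕ) → Σ (Fin (n M')) (ρ (π i))
  follow zero    = s' , r
  follow (suc i) = proj₁ (sim (proj₂ (follow i)) (edge i))
                 , proj₂ (proj₂ (sim (proj₂ (follow i)) (edge i)))

  nextEdge : ∀ i → R M' (proj₁ (follow i)) (proj₁ (follow (suc i))) ≡ true
  nextEdge i = proj₁ (proj₂ (sim (proj₂ (follow i)) (edge i)))

record IsBisimVia {AP B B' : Set} (M : Kripke B) (M' : Kripke B')
                  (ι : AP → B) (ι' : AP → B')
                  (ρ : Fin (n M) → Fin (n M') → Set) : Set where
  field
    labels : ∀ {s s'} → ρ s s' → ∀ p → I M s (ι p) ≡ I M' s' (ι' p)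
    forth  : Simulation M M' ρ
    back   : Simulation M' M (flip ρ)

module Transfer {AP B B' : Set} (_≟_ : DecidableEquality AP)
  {M : Kripke B} {M' : Kripke B'} {ι : AP → B} {ι' : AP → B'}
  {ρ : Fin (n M) → Fin (n M') → Set} (bisim : IsBisimVia M M' ι ι' ρ)
  (ψ : SF AP) {x : SF B} {x' : SF B'}
  (agree : ∀ {s s'} → ρ s s' → Sem._⊨ₛ_ M s x ⇔ Sem._⊨ₛ_ M' s' x')
  where
  open FormulaEq _≟_
  open Vacuity _≟_
  open IsBisimVia bisim
  module S = Sem M
  module S' = Sem M'

  Related : S.Path → S'.Path → Set
  Related = PathRel M M' ρ

  suffixRel : ∀ {π π'} → Related π π' → ∀ k → Related (S.suffix π k) (S'.suffix π' k)
  suffixRel pr k i = pr (i + k)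

  mutual
    transferₛ : (φ : SF AP) → ∀ {s s'} → ρ s s' →
                S._⊨ₛ_ s (replS ι ψ x φ) ⇔ S'._⊨ₛ_ s' (replS ι' ψ x' φ)
    transferₛ φ r with decS φ ψ
    ... | yes _ = agree r
    ... | no _  = transferStep φ r

    transferStep : (φ : SF AP) → ∀ {s s'} → ρ s s' →
                   S._⊨ₛ_ s (goS ι ψ x φ) ⇔ S'._⊨ₛ_ s' (goS ι' ψ x' φ)
    transferStep tt       r = mk⇔ id id
    transferStep (atom p) r = mk⇔ (trans (sym (labels r p))) (trans (labels r p))
    transferStep (¬ₛ f)   r = ¬-cong-⇔ (transferₛ f r)
    transferStep (f ∧ₛ g) r = transferₛ f r ×-⇔ transferₛ g r
    transferStep (𝐄 f) r = mk⇔
      (λ { (π , refl , h) → let (π' , start , pr) = liftPath {M = M} {M'} forth π r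
                            in π' , start , to (transferₚ f {π} {π'} pr) h })
      (λ { (π' , refl , h) → let (π , start , pr) = liftPath {M = M'} {M} back π' r
                             in π , start , from (transferₚ f {π} {π'} pr) h })

    transferₚ : (f : PF AP) → ∀ {π π'} → Related π π' →
                S._⊨ₚ_ π (replP ι ψ x f) ⇔ S'._⊨ₚ_ π' (replP ι' ψ x' f)
    transferₚ (st f)   pr = transferₛ f (pr 0)
    transferₚ (¬ₚ f)   pr = ¬-cong-⇔ (transferₚ f pr)
    transferₚ (f ∧ₚ g) pr = transferₚ f pr ×-⇔ transferₚ g pr
    transferₚ (𝐗 f) {π} {π'} pr = transferₚ f (suffixRel {π} {π'} pr 1)
    transferₚ (f 𝐔 g) {π} {π'} pr = mk⇔
      (λ { (k , now , before) → k , to (atSuffix g k) now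
                              , (λ j j<k → to (atSuffix f j) (before j j<k)) })
      (λ { (k , now , before) → k , from (atSuffix g k) now
                              , (λ j j<k → from (atSuffix f j) (before j j<k)) })
      where
      atSuffix : (h : PF AP) (k : ℕ) →
                 S._⊨ₚ_ (S.suffix π k) (replP ι ψ x h) ⇔ S'._⊨ₚ_ (S'.suffix π' k) (replP ι' ψ x' h)
      atSuffix h k = transferₚ h (suffixRel {π} {π'} pr k)

identityBisim : {AP B : Set} (M : Kripke B) (ι : AP → B) → IsBisimVia M M ι ι _≡_
identityBisim M ι = record
  { labels = λ { refl p → refl }
  ; forth  = λ { {t = t} refl r → t , r , refl }
  ; back   = λ { {t = t} refl r → t , r , refl } }

extensionBisim : {AP : Set} (K : Kripke AP) → IsBisimVia K (withSets K) id inj₁ _≡_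
extensionBisim K = record
  { labels = λ { refl p → refl }
  ; forth  = λ { {t = t} refl r → t , r , refl }
  ; back   = λ { {t = t} refl r → t , r , refl } }

-- A bisimulation of K and K' is also one of their extensions by sets,
-- as long as only the propositions of AP are required to agree.
extendedBisim : {AP : Set} {K K' : Kripke AP} {ρ : Fin (n K) → Fin (n K') → Set} →
                IsBisim K K' ρ → IsBisimVia (withSets K) (withSets K') inj₁ inj₁ ρ
extendedBisim β = record
  { labels = IsBisim.labels β ; forth = IsBisim.forth β ; back = IsBisim.back β }

bisimilar-refl : {AP : Set} (K : Kripke AP) → Bisimilar K K
bisimilar-refl K = _≡_ , record
  { labels = λ { refl p → refl }
  ; forth  = λ { {t = t} refl r → t , r , refl }
  ; back   = λ { {t' = t} refl r → t , r , refl } } , refl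

module SelfSubstitution {AP : Set} (_≟_ : DecidableEquality AP) (ψ : SF AP) where
  open FormulaEq _≟_
  open Vacuity _≟_

  mutual
    substSelfₛ : (φ : SF AP) → replS id ψ ψ φ ≡ φ
    substSelfₛ φ with decS φ ψ
    ... | yes refl = refl
    ... | no _     = substSelfStep φ

    substSelfStep : (φ : SF AP) → goS id ψ ψ φ ≡ φ
    substSelfStep tt       = refl
    substSelfStep (atom p) = refl
    substSelfStep (¬ₛ f)   = cong ¬ₛ (substSelfₛ f)
    substSelfStep (f ∧ₛ g) = cong₂ _∧ₛ_ (substSelfₛ f) (substSelfₛ g)
    substSelfStep (𝐄 f)    = cong 𝐄 (substSelfₚ f)

    substSelfₚ : (f : PF AP) → replP id ψ ψ f ≡ f
    substSelfₚ (st f)   = cong st (substSelfₛ f)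
    substSelfₚ (¬ₚ f)   = cong ¬ₚ (substSelfₚ f)
    substSelfₚ (f ∧ₚ g) = cong₂ _∧ₚ_ (substSelfₚ f) (substSelfₚ g)
    substSelfₚ (𝐗 f)    = cong 𝐗 (substSelfₚ f)
    substSelfₚ (f 𝐔 g)  = cong₂ _𝐔_ (substSelfₚ f) (substSelfₚ g)

constSet : ∀ {m} → Bool → Subset m
constSet b = replicate _ b

constF : {C : Set} → Bool → SF C
constF true  = tt
constF false = ¬ₛ tt

constF⇔constSet : {C : Set} (M : Kripke C) (s : Fin (n M)) {m : ℕ} (t : Fin m) (b : Bool) →
                  Sem._⊨ₛ_ M s (constF b) ⇔ (lookup (constSet b) t ≡ true)
constF⇔constSet M s t true  rewrite lookup-replicate t true  = mk⇔ (λ _ → refl) (λ _ → ⋆)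
constF⇔constSet M s t false rewrite lookup-replicate t false = mk⇔ (λ ¬⊤ → ⊥-elim (¬⊤ ⋆)) (λ ())

constSet⇔constSet : {m m' : ℕ} (t : Fin m) (t' : Fin m') (b : Bool) →
                    (lookup (constSet b) t ≡ true) ⇔ (lookup (constSet b) t' ≡ true)
constSet⇔constSet t t' b rewrite lookup-replicate t b | lookup-replicate t' b = mk⇔ id id

constF-false⇒ : {C : Set} (x : SF C) → Valid⇒ (constF false) x
constF-false⇒ x M s ¬⊤ = ⊥-elim (¬⊤ ⋆)

⇒constF-true : {C : Set} (x : SF C) → Valid⇒ x (constF true)
⇒constF-true x M s _ = ⋆

decided : {P : Set} (d : Dec P) → P ⇔ (does d ≡ true)
decided (yes p) = mk⇔ (λ _ → refl) (λ _ → p)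
decided (no ¬p) = mk⇔ (λ p → ⊥-elim (¬p p)) (λ ())

module VacuityTheory {AP : Set} (_≟_ : DecidableEquality AP) (φ ψ : SF AP) where
  open Vacuity _≟_

  Holds : (M : Kripke AP) → Subset (n M) → Set
  Holds M Y = Sem.⊨_ (withSets M) (_[_←Y_] {M} φ ψ Y)

  formula⇔set : (K : Kripke AP) (ψ' : SF AP) (Y : Subset (n K)) →
                (∀ s → Sem._⊨ₛ_ K s ψ' ⇔ (lookup Y s ≡ true)) →
                Sem.⊨_ K (φ [ ψ ← ψ' ]) ⇔ Holds K Y
  formula⇔set K ψ' Y agree =
    Transfer.transferₛ _≟_ (extensionBisim K) ψ (λ { {s} refl → agree s }) φ refl

  constInstance : (K : Kripke AP) (b : Bool) →
                  Sem.⊨_ K (φ [ ψ ← constF b ]) ⇔ Holds K (constSet b)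
  constInstance K b = formula⇔set K (constF b) (constSet b) λ s → constF⇔constSet K s s b

  extendedConstInstance : (M : Kripke AP) (b : Bool) →
    Sem.⊨_ (withSets M) (φ [ ψ ←⁺ constF b ]) ⇔ Holds M (constSet b)
  extendedConstInstance M b =
    Transfer.transferₛ _≟_ (identityBisim (withSets M) inj₁) ψ
      (λ { {s} refl → constF⇔constSet (withSets M) s s b }) φ refl

  constSet-invariant : {K K' : Kripke AP} → Bisimilar K K' → (b : Bool) →
                       Holds K (constSet b) ⇔ Holds K' (constSet b)
  constSet-invariant (ρ , β , r₀) b =
    Transfer.transferₛ _≟_ (extendedBisim β) ψ (λ {s} {s'} _ → constSet⇔constSet s s' b) φ r₀

  Squeezed : Bool → Set
  Squeezed b = ∀ (M : Kripke AP) (Y : Subset (n M)) →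
               (Holds M (constSet b) → Holds M Y) × (Holds M Y → Holds M (constSet (not b)))

  -- Monotonicity yields a squeeze: increasing φ with b = false, decreasing
  -- φ with b = true.  The sets Y enter as fresh atomic propositions.
  squeeze : Monotone φ ψ → Σ Bool Squeezed
  squeeze (inj₁ up) = false , λ M Y →
      (λ h → up _ (constF false) (atom (inj₂ Y)) (constF-false⇒ _) (withSets M) (s₀ M)
               (from (extendedConstInstance M false) h))
    , (λ h → to (extendedConstInstance M true)
               (up _ (atom (inj₂ Y)) (constF true) (⇒constF-true _) (withSets M) (s₀ M) h))
  squeeze (inj₂ down) = true , λ M Y →
      (λ h → down _ (atom (inj₂ Y)) (constF true) (⇒constF-true _) (withSets M) (s₀ M)
               (from (extendedConstInstance M true) h))
    , (λ h → to (extendedConstInstance M false)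
               (down _ (constF false) (atom (inj₂ Y)) (constF-false⇒ _) (withSets M) (s₀ M) h))

  ExtremeVacuous : Bool → Kripke AP → Set
  ExtremeVacuous b K = Holds K (constSet b) ⊎ ¬ Holds K (constSet (not b))

  structure⇔extreme : {b : Bool} → Squeezed b → (K : Kripke AP) →
                      StructureVacuous K φ ψ ⇔ ExtremeVacuous b K
  structure⇔extreme squeezed K = mk⇔
    (λ { (inj₁ all) → inj₁ (all _) ; (inj₂ none) → inj₂ (none _) })
    (λ { (inj₁ low)   → inj₁ λ Y → proj₁ (squeezed K Y) low
       ; (inj₂ ¬high) → inj₂ λ Y h → ¬high (proj₂ (squeezed K Y) h) })

  -- Extreme vacuity transfers to every bisimilar structure, where the
  -- squeeze spreads it over all sets of states.
  extreme→bisimulation : {b : Bool} → Squeezed b → (K : Kripke AP) →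
                         ExtremeVacuous b K → BisimulationVacuous K φ ψ
  extreme→bisimulation {b} squeezed K (inj₁ low) = inj₁ λ K' β Y →
    proj₁ (squeezed K' Y) (to (constSet-invariant β b) low)
  extreme→bisimulation {b} squeezed K (inj₂ ¬high) = inj₂ λ K' β Y h →
    ¬high (from (constSet-invariant β (not b)) (proj₂ (squeezed K' Y) h))

  -- K itself is among its bisimilar structures.
  bisimulation→structure : (K : Kripke AP) → BisimulationVacuous K φ ψ → StructureVacuous K φ ψ
  bisimulation→structure K (inj₁ all)  = inj₁ (all K (bisimilar-refl K))
  bisimulation→structure K (inj₂ none) = inj₂ (none K (bisimilar-refl K))

  -- Classically every state formula ψ' is matched by the set of states
  -- satisfying it, which relates syntactic instances to structure instances.
  module Classical (em : ExcludedMiddle 0ℓ) (K : Kripke AP) where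
    satSet : SF AP → Subset (n K)
    satSet ψ' = tabulate λ s → does (em {Sem._⊨ₛ_ K s ψ'})

    formula⇔satSet : (ψ' : SF AP) → Sem.⊨_ K (φ [ ψ ← ψ' ]) ⇔ Holds K (satSet ψ')
    formula⇔satSet ψ' = formula⇔set K ψ' (satSet ψ') λ s →
      subst (λ v → Sem._⊨ₛ_ K s ψ' ⇔ (v ≡ true)) (sym (lookup∘tabulate _ s)) (decided em)

    -- φ itself is the instance φ[ψ ← ψ].
    φ⇔satSet : Sem.⊨_ K φ ⇔ Holds K (satSet ψ)
    φ⇔satSet = subst (λ χ → Sem.⊨_ K χ ⇔ Holds K (satSet ψ))
                        (SelfSubstitution.substSelfₛ _≟_ ψ φ) (formula⇔satSet ψ)

    structure→syntactic : StructureVacuous K φ ψ → SyntacticVacuous K φ ψ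
    structure→syntactic (inj₁ all) ψ' =
      (λ _ → from (formula⇔satSet ψ') (all _)) , (λ _ → from φ⇔satSet (all _))
    structure→syntactic (inj₂ none) ψ' =
      (λ h → ⊥-elim (none _ (to φ⇔satSet h))) , (λ h → ⊥-elim (none _ (to (formula⇔satSet ψ') h)))

    -- The constant formulas are particular substitutes: if K ⊨ φ then
    -- φ[ψ ← constF b] holds, otherwise φ[ψ ← constF (not b)] fails.
    syntactic→extreme : (b : Bool) → SyntacticVacuous K φ ψ → ExtremeVacuous b K
    syntactic→extreme b sv with em {Sem.⊨_ K φ}
    ... | yes h  = inj₁ (to (constInstance K b) (proj₁ (sv (constF b)) h))
    ... | no ¬h  = inj₂ λ h → ¬h (proj₂ (sv (constF (not b))) (from (constInstance K (not b)) h))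

theorem4p5 : ExcludedMiddle 0ℓ →
    ∀ {AP : Set} (_≟_ : DecidableEquality AP) (K : Kripke AP) (φ ψ : SF AP) →
    ψ ⊑ₛ φ → Vacuity.Monotone _≟_ φ ψ →
    (Vacuity.SyntacticVacuous _≟_ K φ ψ ⇔ Vacuity.StructureVacuous _≟_ K φ ψ)
    × (Vacuity.StructureVacuous _≟_ K φ ψ ⇔ Vacuity.BisimulationVacuous _≟_ K φ ψ)
theorem4p5 em _≟_ K φ ψ _ monotone =
    mk⇔ (λ sv → from structure⇔extremeK (syntactic→extreme b sv)) structure→syntactic
  , mk⇔ (λ stv → extreme→bisimulation squeezed K (to structure⇔extremeK stv))
        (bisimulation→structure K)
  where
  open Vacuity _≟_
  open VacuityTheory _≟_ φ ψ
  open Classical em K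

  b : Bool
  b = proj₁ (squeeze monotone)

  squeezed : Squeezed b
  squeezed = proj₂ (squeeze monotone)

  structure⇔extremeK : StructureVacuous K φ ψ ⇔ ExtremeVacuous b K
  structure⇔extremeK = structure⇔extreme squeezed K
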